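{- Consider the reversed Zeckendorf game started from the position consisting of $a$ chips of value $1 = F_1$, $b$ chips of value $2 = F_2$ and $c$ chips of value $3 = F_3$ (and no other chips), where $a,b,c \geq 0$ are integers, with Player 1 moving first. Then: (1) if $a,b,c$ are all even, Player 2 has a forced win; (2) if $a,b,c$ are all odd, Player 1 has a forced win; (3) if $a$ even, $b$ odd, $c$ even, Player 1 has a forced win; (4) if $a$ odd, $b$ even, $c$ odd, Player 1 has a forced win; (5) if $a$ odd, $b$ even, $c$ even and $a > c$, Player 2 has a forced win; (6) if $a$ odd, $b$ even, $c$ even and $a < c$, Player 1 has a forced win; (7) if $a$ even, $b$ even, $c$ odd and $a > c$, Player 1 has a forced win; (8) if $a$ even, $b$ even, $c$ odd and $a < c$, Player 2 has a forced win; (9) if $a$ even, $b$ odd, $c$ odd, Player 1 has a forced win; (10) if $a$ odd, $b$ odd, $c$ even, Player 1 has a forced win.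
   Context: Fibonacci numbers are indexed $F_1=1$, $F_2=2$, $F_{k+1}=F_k+F_{k-1}$. A game state is a multiset of Fibonacci numbers ("chips"); the number of chips equal to $F_k$ is the height $h_k$ of bin $k$. In the reversed Zeckendorf game, two players alternate moves from a given starting state; the legal moves are: (Split) for $k \geq 3$, if $h_k \geq 1$, replace one chip $F_k$ by one chip $F_{k-1}$ and one chip $F_{k-2}$; and if $h_2 \geq 1$, replace one chip $F_2$ by two chips $F_1$. (Combine) for $k > 2$, if $h_{k-2}\ge1$ and $h_{k+1} \geq 1$, replace one chip $F_{k-2}$ and one chip $F_{k+1}$ by two chips $F_k$; and if $h_1 \geq 1$ and $h_3 \geq 1$, replace one chip $F_1$ and one chip $F_3$ by two chips $F_2$. A player who cannot move loses. -}

module Defs where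

open import Data.Nat using (ℕ; zero; suc; _+_; _∸_; _≤_; _<_; _≡ᵇ_)
open import Data.Nat.Divisibility using (_∣_)
open import Data.Bool using (if_then_else_)
open import Data.Product using (Σ; _×_)
open import Relation.Nullary using (¬_)

-- A game state: h k = number of chips equal to F_k (bins indexed from 1;
-- the value at index 0 is never used by any move).
-- Fibonacci convention: F_1 = 1, F_2 = 2, F_3 = 3, F_{k+1} = F_k + F_{k-1}.
State : Set
State = ℕ → ℕ

inc : ℕ → State → State
inc k h i = if i ≡ᵇ k then suc (h i) else h i

-- remove one chip from bin k (used only when h k ≥ 1)
dec : ℕ → State → State
dec k h i = if i ≡ᵇ k then h i ∸ 1 else h i

data Move (h : State) : State → Set where
  split    : (k : ℕ) → 3 ≤ k → 1 ≤ h k →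
             Move h (inc (k ∸ 2) (inc (k ∸ 1) (dec k h)))
  split₂   : 1 ≤ h 2 →
             Move h (inc 1 (inc 1 (dec 2 h)))
  combine  : (k : ℕ) → 2 < k → 1 ≤ h (k ∸ 2) → 1 ≤ h (suc k) →
             Move h (inc k (inc k (dec (k ∸ 2) (dec (suc k) h))))
  combine₂ : 1 ≤ h 1 → 1 ≤ h 3 →
             Move h (inc 2 (inc 2 (dec 1 (dec 3 h))))

-- Winning / losing positions for the player about to move
-- (normal play: a player who cannot move loses).
data Win  (h : State) : Set
data Lose (h : State) : Set

data Win h where
  win : (h' : State) → Move h h' → Lose h' → Win h

data Lose h where
  lose : ((h' : State) → Move h h' → Win h') → Lose h

start : ℕ → ℕ → ℕ → State
start a b c 1 = a
start a b c 2 = b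
start a b c 3 = c
start a b c _ = 0

-- Player 1 moves first from the start position.
Player1Wins : State → Set
Player1Wins = Win

Player2Wins : State → Set
Player2Wins = Lose

Even : ℕ → Set
Even n = 2 ∣ n

Odd : ℕ → Set
Odd n = ¬ (2 ∣ n)

-- Only the first three bins are ever occupied, so a position is a triple
-- (x , y , z) of chip counts, and the legal moves are: split an F₃, split an
-- F₂, or combine F₁ + F₃ into 2 F₂. The P-positions (the player to move loses)
-- are those with y and min x z both even. Every move from such a position
-- changes the parity of y (the two splits) or of min x z (the combination,
-- which lowers x and z by one each and keeps the parity of y). Conversely,
-- if y is even and min x z odd, combining restores a P-position; if y is odd,
-- of the two splits exactly one leaves min x z even, since after splitting
-- an F₂ the minimum is min (x + 2) z and after splitting an F₃ it is
-- min (x + 1) (z - 1). The game is finite as each move lowers (z , y)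
-- lexicographically.
module Submission where

open import Defs
open import Data.Nat.Base using (ℕ; zero; suc; _+_; _*_; _∸_; _⊓_; _<_; _≤_; _≡ᵇ_; s≤s; z≤n; parity)
open import Data.Nat.Properties using (≤-refl; <⇒≤; m≤n⇒m⊓n≡m; m≥n⇒m⊓n≡n; ⊓-sel)
open import Data.Nat.Divisibility using (divides; ∣-refl; ∣m∣n⇒∣m+n)
open import Data.Nat.Induction using (<-wellFounded)
open import Data.Parity.Base using (0ℙ; 1ℙ; _⁻¹)
open import Data.Parity.Properties using (suc-homo-⁻¹)
open import Data.Product using (_×_; _,_; -,_; ∃-syntax)
open import Data.Product.Relation.Binary.Lex.Strict using (×-Lex; ×-wellFounded)
open import Data.Sum using (_⊎_; inj₁; inj₂)
open import Data.Bool.Base using (if_then_else_)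
open import Data.Empty using (⊥-elim)
open import Function.Base using (flip; _∘_)
open import Induction.WellFounded using (WellFounded; Acc; acc; module Subrelation)
open import Relation.Binary.Construct.On as On using ()
open import Relation.Binary.PropositionalEquality
  using (_≡_; refl; sym; trans; cong; subst; _≗_)

parity-pred : ∀ n {p} → parity (suc n) ≡ p → parity n ≡ p ⁻¹
parity-pred n e = trans (sym (suc-homo-⁻¹ n)) (cong _⁻¹ e)

parity-suc : ∀ n {p} → parity n ≡ p → parity (suc n) ≡ p ⁻¹
parity-suc n = parity-pred (suc n)

Even⇒parity≡0ℙ : ∀ {n} → Even n → parity n ≡ 0ℙ
Even⇒parity≡0ℙ (divides q refl) = parity-double q
  where
  parity-double : ∀ q → parity (q * 2) ≡ 0ℙ
  parity-double zero    = refl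
  parity-double (suc q) = parity-double q

Odd⇒parity≡1ℙ : ∀ {n} → Odd n → parity n ≡ 1ℙ
Odd⇒parity≡1ℙ {zero}        odd = ⊥-elim (odd (divides 0 refl))
Odd⇒parity≡1ℙ {suc zero}    _   = refl
Odd⇒parity≡1ℙ {suc (suc n)} odd = Odd⇒parity≡1ℙ (odd ∘ ∣m∣n⇒∣m+n (∣-refl {2}))

parity-⊓ : ∀ m n {p} → parity m ≡ p → parity n ≡ p → parity (m ⊓ n) ≡ p
parity-⊓ m n pm pn with ⊓-sel m n
... | inj₁ m⊓n≡m = subst (λ k → parity k ≡ _) (sym m⊓n≡m) pm
... | inj₂ m⊓n≡n = subst (λ k → parity k ≡ _) (sym m⊓n≡n) pn


Pos : Set
Pos = ℕ × ℕ × ℕ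

data _↝_ : Pos → Pos → Set where
  split₃   : ∀ {x y z} → (x , y , suc z) ↝ (suc x , suc y , z)
  split₂   : ∀ {x y z} → (x , suc y , z) ↝ (suc (suc x) , y , z)
  combine₂ : ∀ {x y z} → (suc x , y , suc z) ↝ (x , suc (suc y) , z)

↝-wellFounded : WellFounded (flip _↝_)
↝-wellFounded =
  Subrelation.wellFounded ↝-lowers-rank (On.wellFounded rank (×-wellFounded <-wellFounded <-wellFounded))
  where
  rank : Pos → ℕ × ℕ
  rank (_ , y , z) = z , y

  ↝-lowers-rank : ∀ {p q} → p ↝ q → ×-Lex _≡_ _<_ _<_ (rank q) (rank p)
  ↝-lowers-rank split₃   = inj₁ ≤-refl
  ↝-lowers-rank split₂   = inj₂ (refl , ≤-refl)
  ↝-lowers-rank combine₂ = inj₁ ≤-refl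

P-position : Pos → Set
P-position (x , y , z) = parity y ≡ 0ℙ × parity (x ⊓ z) ≡ 0ℙ

N-position : Pos → Set
N-position (x , y , z) = parity y ≡ 1ℙ ⊎ (parity y ≡ 0ℙ × parity (x ⊓ z) ≡ 1ℙ)

P-position-↝ : ∀ {p q} → P-position p → p ↝ q → N-position q
P-position-↝ {_ , y , _}         (py , _)  split₃   = inj₁ (parity-suc y py)
P-position-↝ {_ , suc y , _}     (py , _)  split₂   = inj₁ (parity-pred y py)
P-position-↝ {suc x , _ , suc z} (py , pm) combine₂ = inj₂ (py , parity-pred (x ⊓ z) pm)

N-position-↝ : ∀ {p} → N-position p → ∃[ q ] p ↝ q × P-position q
N-position-↝ {suc x , y , suc z} (inj₂ (py , pm)) = -, combine₂ , py , parity-pred (x ⊓ z) pm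
N-position-↝ {x , suc y , zero}  (inj₁ py)        = -, split₂ , parity-pred y py , refl
N-position-↝ {x , suc y , suc z} (inj₁ py) with parity (suc (suc x) ⊓ suc z) in pm
... | 0ℙ = -, split₂ , parity-pred y py , pm
... | 1ℙ = -, split₃ , parity-pred y py , parity-pred (suc x ⊓ z) pm

state : Pos → State
state (x , y , z) = start x y z

effect : ∀ {p q} → p ↝ q → State → State
effect split₃   h = inc 1 (inc 2 (dec 3 h))
effect split₂   h = inc 1 (inc 1 (dec 2 h))
effect combine₂ h = inc 2 (inc 2 (dec 1 (dec 3 h)))

inc-cong : ∀ {h g} k → h ≗ g → inc k h ≗ inc k g
inc-cong k h≗g i = cong (λ v → if i ≡ᵇ k then suc v else v) (h≗g i)

dec-cong : ∀ {h g} k → h ≗ g → dec k h ≗ dec k g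
dec-cong k h≗g i = cong (λ v → if i ≡ᵇ k then v ∸ 1 else v) (h≗g i)

effect-cong : ∀ {p q h g} (s : p ↝ q) → h ≗ g → effect s h ≗ effect s g
effect-cong split₃   = inc-cong 1 ∘ inc-cong 2 ∘ dec-cong 3
effect-cong split₂   = inc-cong 1 ∘ inc-cong 1 ∘ dec-cong 2
effect-cong combine₂ = inc-cong 2 ∘ inc-cong 2 ∘ dec-cong 1 ∘ dec-cong 3

effect-state : ∀ {p q} (s : p ↝ q) → effect s (state p) ≗ state q
effect-state split₃   = λ { 0 → refl ; 1 → refl ; 2 → refl ; 3 → refl ; (suc (suc (suc (suc _)))) → refl }
effect-state split₂   = λ { 0 → refl ; 1 → refl ; 2 → refl ; 3 → refl ; (suc (suc (suc (suc _)))) → refl }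
effect-state combine₂ = λ { 0 → refl ; 1 → refl ; 2 → refl ; 3 → refl ; (suc (suc (suc (suc _)))) → refl }

effect-≗ : ∀ {p q h} (s : p ↝ q) → h ≗ state p → effect s h ≗ state q
effect-≗ s h≗p i = trans (effect-cong s h≗p i) (effect-state s i)

≗-occupied : ∀ {h g : State} k → h ≗ g → 1 ≤ h k → 1 ≤ g k
≗-occupied k h≗g = subst (1 ≤_) (h≗g k)

↝⇒Move : ∀ {p q h} (s : p ↝ q) → h ≗ state p → Move h (effect s h)
↝⇒Move split₃   h≗p = split 3 (s≤s (s≤s (s≤s z≤n))) (≗-occupied 3 (sym ∘ h≗p) (s≤s z≤n))
↝⇒Move split₂   h≗p = split₂ (≗-occupied 2 (sym ∘ h≗p) (s≤s z≤n))
↝⇒Move combine₂ h≗p = combine₂ (≗-occupied 1 (sym ∘ h≗p) (s≤s z≤n)) (≗-occupied 3 (sym ∘ h≗p) (s≤s z≤n))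

Move⇒↝ : ∀ {p h h'} → h ≗ state p → Move h h' → ∃[ q ] p ↝ q × h' ≗ state q
Move⇒↝ _ (split 1 (s≤s ()) _)
Move⇒↝ _ (split 2 (s≤s (s≤s ())) _)
Move⇒↝ h≗p (split 3 _ occ) with ≗-occupied 3 h≗p occ
... | s≤s _ = -, split₃ , effect-≗ split₃ h≗p
Move⇒↝ h≗p (split (suc (suc (suc (suc k)))) _ occ) with ≗-occupied (4 + k) h≗p occ
... | ()
Move⇒↝ h≗p (split₂ occ) with ≗-occupied 2 h≗p occ
... | s≤s _ = -, split₂ , effect-≗ split₂ h≗p
Move⇒↝ _ (combine 1 (s≤s ()) _ _)
Move⇒↝ _ (combine 2 (s≤s (s≤s ())) _ _)
Move⇒↝ h≗p (combine (suc (suc (suc k))) _ _ occ) with ≗-occupied (4 + k) h≗p occ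
... | ()
Move⇒↝ h≗p (combine₂ occ₁ occ₃) with ≗-occupied 1 h≗p occ₁ | ≗-occupied 3 h≗p occ₃
... | s≤s _ | s≤s _ = -, combine₂ , effect-≗ combine₂ h≗p

P-position⇒Lose : ∀ {p h} → Acc (flip _↝_) p → P-position p → h ≗ state p → Lose h
N-position⇒Win  : ∀ {p h} → Acc (flip _↝_) p → N-position p → h ≗ state p → Win h

P-position⇒Lose (acc rs) P h≗p = lose λ _ m →
  let (_ , s , h'≗q) = Move⇒↝ h≗p m in N-position⇒Win (rs s) (P-position-↝ P s) h'≗q

N-position⇒Win (acc rs) N h≗p =
  let (_ , s , P) = N-position-↝ N in win _ (↝⇒Move s h≗p) (P-position⇒Lose (rs s) P (effect-≗ s h≗p))

theorem1p6 : (a b c : ℕ) →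
    ((Even a → Even b → Even c → Player2Wins (start a b c))
    × (Odd a → Odd b → Odd c → Player1Wins (start a b c))
    × (Even a → Odd b → Even c → Player1Wins (start a b c))
    × (Odd a → Even b → Odd c → Player1Wins (start a b c))
    × (Odd a → Even b → Even c → c < a → Player2Wins (start a b c))
    × (Odd a → Even b → Even c → a < c → Player1Wins (start a b c))
    × (Even a → Even b → Odd c → c < a → Player1Wins (start a b c))
    × (Even a → Even b → Odd c → a < c → Player2Wins (start a b c))
    × (Even a → Odd b → Odd c → Player1Wins (start a b c))
    × (Odd a → Odd b → Even c → Player1Wins (start a b c)))
theorem1p6 a b c =
    (λ ea eb ec → lost (even eb , parity-⊓ a c (even ea) (even ec)))
  , (λ _ ob _ → won (inj₁ (odd ob)))
  , (λ _ ob _ → won (inj₁ (odd ob)))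
  , (λ oa eb oc → won (inj₂ (even eb , parity-⊓ a c (odd oa) (odd oc))))
  , (λ _ eb ec c<a → lost (even eb , min-right c<a (even ec)))
  , (λ oa eb _ a<c → won (inj₂ (even eb , min-left a<c (odd oa))))
  , (λ _ eb oc c<a → won (inj₂ (even eb , min-right c<a (odd oc))))
  , (λ ea eb _ a<c → lost (even eb , min-left a<c (even ea)))
  , (λ _ ob _ → won (inj₁ (odd ob)))
  , (λ _ ob _ → won (inj₁ (odd ob)))
  where
  even : ∀ {n} → Even n → parity n ≡ 0ℙ
  even = Even⇒parity≡0ℙ

  odd : ∀ {n} → Odd n → parity n ≡ 1ℙ
  odd = Odd⇒parity≡1ℙ

  lost : P-position (a , b , c) → Lose (start a b c)
  lost P = P-position⇒Lose (↝-wellFounded _) P λ _ → refl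

  won : N-position (a , b , c) → Win (start a b c)
  won N = N-position⇒Win (↝-wellFounded _) N λ _ → refl

  min-left : ∀ {p} → a < c → parity a ≡ p → parity (a ⊓ c) ≡ p
  min-left a<c = subst (λ k → parity k ≡ _) (sym (m≤n⇒m⊓n≡m (<⇒≤ a<c)))

  min-right : ∀ {p} → c < a → parity c ≡ p → parity (a ⊓ c) ≡ p
  min-right c<a = subst (λ k → parity k ≡ _) (sym (m≥n⇒m⊓n≡n (<⇒≤ c<a)))
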